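{- (1) Let $L$ and $M$ be dcpo-$\vee_{\uparrow}$-semilattices and $f : L \to M$ a function. Then $f$ is a dcpo-$\vee_{\uparrow}$-semilattice homomorphism if and only if $f$ is $F$-Scott continuous. (2) Let $L$ be a dcpo-$\vee_{\uparrow}$-semilattice and $A \subseteq L$ a nonempty consistent subset. Then $cl_{F}(A) = \downarrow \bigvee A$.
   Context: A subset of a poset is consistent if it has an upper bound. A dcpo-$\vee_{\uparrow}$-semilattice is a dcpo in which every consistent pair of elements has a join (hence every nonempty finite consistent set has a join). A dcpo-$\vee_{\uparrow}$-semilattice homomorphism is a map preserving suprema of directed sets and joins of nonempty finite consistent sets (equivalently, a Scott continuous map preserving joins of consistent pairs). A subset $A$ of a dcpo-$\vee_{\uparrow}$-semilattice $L$ is $F$-Scott closed if it is Scott closed (a lower set closed under directed suprema) and $\bigvee F \in A$ for every nonempty finite consistent $F \subseteq A$. $cl_F(A)$ denotes the smallest $F$-Scott closed set containing $A$. A function between dcpo-$\vee_{\uparrow}$-semilattices is $F$-Scott continuous if the preimage of every $F$-Scott closed set is $F$-Scott closed. $\downarrow x = \{y : y \le x\}$. -}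

module Defs where

open import Level using (Level; suc; _⊔_)
open import Data.Product using (Σ; ∃; _×_; _,_)
open import Data.Sum using (_⊎_)
open import Data.List using (List; []; _∷_; map)
open import Data.List.Relation.Unary.Any using (Any)
open import Relation.Unary using (Pred; _∈_; _⊆_)
open import Relation.Binary.Bundles using (Poset)

module Order {ℓ : Level} (P : Poset ℓ ℓ ℓ) where
  open Poset P

  Sub : Set (suc ℓ)
  Sub = Pred Carrier ℓ

  UpperBound : Sub → Carrier → Set ℓ
  UpperBound A u = ∀ {x} → x ∈ A → x ≤ u

  IsSup : Sub → Carrier → Set ℓ
  IsSup A s = UpperBound A s × (∀ u → UpperBound A u → s ≤ u)

  Consistent : Sub → Set ℓ
  Consistent A = ∃ λ u → UpperBound A u

  Nonempty : Sub → Set ℓ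
  Nonempty A = ∃ λ x → x ∈ A

  Directed : Sub → Set ℓ
  Directed D = Nonempty D × (∀ {x y} → x ∈ D → y ∈ D → ∃ λ z → z ∈ D × x ≤ z × y ≤ z)

  pair : Carrier → Carrier → Sub
  pair x y z = z ≈ x ⊎ z ≈ y

  listSet : List Carrier → Sub
  listSet xs y = Any (y ≈_) xs

  ↓ : Carrier → Sub
  ↓ x y = y ≤ x

  LowerSet : Sub → Set ℓ
  LowerSet A = ∀ {x y} → y ≤ x → x ∈ A → y ∈ A

  ScottClosed : Sub → Set (suc ℓ)
  ScottClosed A = LowerSet A × (∀ (D : Sub) s → Directed D → D ⊆ A → IsSup D s → s ∈ A)

  FScottClosed : Sub → Set (suc ℓ)
  FScottClosed A = ScottClosed A
    × (∀ x xs s → listSet (x ∷ xs) ⊆ A → Consistent (listSet (x ∷ xs))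
         → IsSup (listSet (x ∷ xs)) s → s ∈ A)

  clF : Sub → Pred Carrier (suc ℓ)
  clF A x = ∀ (C : Sub) → FScottClosed C → A ⊆ C → x ∈ C

record DcpoJoinSL (ℓ : Level) : Set (suc ℓ) where
  field
    poset : Poset ℓ ℓ ℓ
  open Poset poset public
  open Order poset public
  field
    dirSup  : ∀ (D : Sub) → Directed D → ∃ λ s → IsSup D s
    pairJoin : ∀ x y → Consistent (pair x y) → ∃ λ s → IsSup (pair x y) s

module _ {ℓ : Level} (L M : DcpoJoinSL ℓ) where
  private
    module L = DcpoJoinSL L
    module M = DcpoJoinSL M

  image : (L.Carrier → M.Carrier) → L.Sub → M.Sub
  image f D y = ∃ λ x → x ∈ D × y M.≈ f x

  preimage : (L.Carrier → M.Carrier) → M.Sub → L.Sub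
  preimage f A x = f x ∈ A

  PreservesDirectedSups : (L.Carrier → M.Carrier) → Set (suc ℓ)
  PreservesDirectedSups f = ∀ (D : L.Sub) s → L.Directed D → L.IsSup D s
    → M.IsSup (image f D) (f s)

  PreservesFiniteConsistentJoins : (L.Carrier → M.Carrier) → Set ℓ
  PreservesFiniteConsistentJoins f = ∀ x xs s → L.Consistent (L.listSet (x ∷ xs))
    → L.IsSup (L.listSet (x ∷ xs)) s → M.IsSup (M.listSet (map f (x ∷ xs))) (f s)

  IsHom : (L.Carrier → M.Carrier) → Set (suc ℓ)
  IsHom f = PreservesDirectedSups f × PreservesFiniteConsistentJoins f

  FScottContinuous : (L.Carrier → M.Carrier) → Set (suc ℓ)
  FScottContinuous f = ∀ (A : M.Sub) → M.FScottClosed A → L.FScottClosed (preimage f A)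

-- Every principal ideal ↓ v is F-Scott closed, and "f x ≤ v" is the statement
-- "x ∈ f⁻¹(↓ v)"; so preservation of sups by f is exactly F-Scott closedness of
-- the preimages of principal ideals, and conversely a homomorphism is monotone and
-- maps directed sets and finite consistent lists to sets of the same kind.
-- For a nonempty consistent A, the joins of finite lists from A exist (by pairwise
-- joins) and form a directed set, whose sup s is the sup of A.  Every F-Scott
-- closed set containing A contains these finite joins, hence s, hence ↓ s; and
-- ↓ s is itself such a set.
module Submission where

open import Defs
open import Level using (Level)
open import Data.Product using (∃; _×_; _,_; proj₁; proj₂; Σ)
open import Data.Sum using (inj₁; inj₂)
open import Data.List using (List; []; _∷_; map; _++_)
open import Data.List.Relation.Unary.All as All using (All; _∷_; lookupAny)
open import Data.List.Relation.Unary.All.Properties as All using ()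
open import Data.List.Relation.Unary.Any using (here; there)
open import Data.List.Relation.Unary.Any.Properties using (++⁺ˡ; ++⁺ʳ)
open import Function.Bundles using (_⇔_; mk⇔)
open import Relation.Binary.Core using (_Preserves_⟶_)
open import Relation.Unary using (_≐_; _∈_; _⊆_)

module Properties {ℓ : Level} (L : DcpoJoinSL ℓ) where
  open DcpoJoinSL L

  ↓-lowerSet : ∀ v → LowerSet (↓ v)
  ↓-lowerSet v y≤x x≤v = trans y≤x x≤v

  ↓-fScottClosed : ∀ v → FScottClosed (↓ v)
  ↓-fScottClosed v =
    (↓-lowerSet v , λ D s _ D⊆↓v sup → proj₂ sup v D⊆↓v) ,
    λ x xs s xs⊆↓v _ sup → proj₂ sup v xs⊆↓v

  isSup-mono : ∀ {A B s t} → A ⊆ B → IsSup A s → IsSup B t → s ≤ t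
  isSup-mono A⊆B supA supB = proj₂ supA _ (λ a∈A → proj₁ supB (A⊆B a∈A))

  listSet-⊆ : ∀ {C ys} → LowerSet C → All (_∈ C) ys → listSet ys ⊆ C
  listSet-⊆ low ys∈C w∈ys with lookupAny ys∈C w∈ys
  ... | y∈C , w≈y = low (reflexive w≈y) y∈C

  singleton-isSup : ∀ y → IsSup (listSet (y ∷ [])) y
  singleton-isSup y = (λ { (here x≈y) → reflexive x≈y }) , λ v ub → ub (here Eq.refl)

  ≤⇒isSup : ∀ {x y} → y ≤ x → IsSup (listSet (y ∷ x ∷ [])) x
  ≤⇒isSup y≤x = ub , λ v ub → ub (there (here Eq.refl))
    where
    ub : UpperBound (listSet (_ ∷ _ ∷ [])) _
    ub (here z≈y)         = trans (reflexive z≈y) y≤x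
    ub (there (here z≈x)) = reflexive z≈x

  ∷-isSup : ∀ {y ys t s} → IsSup (listSet ys) t → IsSup (pair y t) s
          → IsSup (listSet (y ∷ ys)) s
  ∷-isSup {y} {ys} {t} {s} (t-ub , t-least) (s-ub , s-least) = ub , least
    where
    ub : UpperBound (listSet (y ∷ ys)) s
    ub (here x≈y)  = s-ub (inj₁ x≈y)
    ub (there x∈ys) = trans (t-ub x∈ys) (s-ub (inj₂ Eq.refl))

    least : ∀ v → UpperBound (listSet (y ∷ ys)) v → s ≤ v
    least v v-ub = s-least v λ
      { (inj₁ x≈y) → trans (reflexive x≈y) (v-ub (here Eq.refl))
      ; (inj₂ x≈t) → trans (reflexive x≈t) (t-least v (λ x∈ys → v-ub (there x∈ys)))
      }

  pair-≤ : ∀ {y ys t u} → IsSup (listSet ys) t → UpperBound (listSet (y ∷ ys)) u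
         → UpperBound (pair y t) u
  pair-≤ t-sup u-ub (inj₁ x≈y) = trans (reflexive x≈y) (u-ub (here Eq.refl))
  pair-≤ t-sup u-ub (inj₂ x≈t) =
    trans (reflexive x≈t) (proj₂ t-sup _ (λ x∈ys → u-ub (there x∈ys)))

  listSet-join : ∀ y ys → Consistent (listSet (y ∷ ys)) → ∃ λ s → IsSup (listSet (y ∷ ys)) s
  listSet-join y []       _          = y , singleton-isSup y
  listSet-join y (z ∷ zs) (u , u-ub) with listSet-join z zs (u , λ x∈zs → u-ub (there x∈zs))
  ... | t , t-sup with pairJoin y t (u , pair-≤ t-sup u-ub)
  ... | s , s-sup = s , ∷-isSup t-sup s-sup

  FiniteJoins : Sub → Sub
  FiniteJoins A x =
    Σ Carrier λ y → Σ (List Carrier) λ ys → All (_∈ A) (y ∷ ys) × IsSup (listSet (y ∷ ys)) x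

  ⊆-finiteJoins : ∀ {A} → A ⊆ FiniteJoins A
  ⊆-finiteJoins {x = a} a∈A = a , [] , a∈A ∷ All.[] , singleton-isSup a

  module _ {A : Sub} (A-consistent : Consistent A) where
    private
      u = proj₁ A-consistent

      A⊆↓u : A ⊆ ↓ u
      A⊆↓u = proj₂ A-consistent

    finiteJoins-directed : Nonempty A → Directed (FiniteJoins A)
    finiteJoins-directed (a , a∈A) = (a , ⊆-finiteJoins a∈A) , bound
      where
      bound : ∀ {x x′} → x ∈ FiniteJoins A → x′ ∈ FiniteJoins A
            → ∃ λ z → z ∈ FiniteJoins A × x ≤ z × x′ ≤ z
      bound (y , ys , ys∈A , x-sup) (y′ , ys′ , ys′∈A , x′-sup)
        with listSet-join y (ys ++ y′ ∷ ys′)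
               (u , listSet-⊆ (↓-lowerSet u) (All.map A⊆↓u (All.++⁺ ys∈A ys′∈A)))
      ... | z , z-sup =
        z , (y , ys ++ y′ ∷ ys′ , All.++⁺ ys∈A ys′∈A , z-sup) ,
        isSup-mono ++⁺ˡ x-sup z-sup ,
        isSup-mono (++⁺ʳ (y ∷ ys)) x′-sup z-sup

    finiteJoins-⊆ : ∀ {C} → FScottClosed C → A ⊆ C → FiniteJoins A ⊆ C
    finiteJoins-⊆ ((low , _) , finite) A⊆C (y , ys , ys∈A , x-sup) =
      finite y ys _ (listSet-⊆ low (All.map A⊆C ys∈A))
        (u , listSet-⊆ (↓-lowerSet u) (All.map A⊆↓u ys∈A)) x-sup

  isSup-finiteJoins⇒isSup : ∀ {A s} → IsSup (FiniteJoins A) s → IsSup A s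
  isSup-finiteJoins⇒isSup (s-ub , s-least) =
    (λ a∈A → s-ub (⊆-finiteJoins a∈A)) ,
    λ v A⊆↓v → s-least v λ (_ , _ , ys∈A , x-sup) →
      proj₂ x-sup v (listSet-⊆ (↓-lowerSet v) (All.map A⊆↓v ys∈A))

  consistent-sup-clF : ∀ {A} → Nonempty A → Consistent A
                     → ∃ λ s → IsSup A s × (clF A ≐ ↓ s)
  consistent-sup-clF {A} nonempty consistent
    with dirSup (FiniteJoins A) (finiteJoins-directed consistent nonempty)
  ... | s , s-sup = s , A-sup , clF⊆↓s , ↓s⊆clF
    where
    A-sup : IsSup A s
    A-sup = isSup-finiteJoins⇒isSup s-sup

    clF⊆↓s : clF A ⊆ ↓ s
    clF⊆↓s x∈clF = x∈clF (↓ s) (↓-fScottClosed s) (proj₁ A-sup)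

    ↓s⊆clF : ↓ s ⊆ clF A
    ↓s⊆clF x≤s C C-closed@((low , directed) , _) A⊆C =
      low x≤s (directed (FiniteJoins A) s (finiteJoins-directed consistent nonempty)
                 (finiteJoins-⊆ consistent C-closed A⊆C) s-sup)

module Homomorphisms {ℓ : Level} (L M : DcpoJoinSL ℓ) where
  private
    module L = DcpoJoinSL L
    module M = DcpoJoinSL M
  open Properties L using (≤⇒isSup)
  open Properties M using (↓-lowerSet; ↓-fScottClosed)

  Monotone : (L.Carrier → M.Carrier) → Set ℓ
  Monotone f = f Preserves L._≤_ ⟶ M._≤_

  module _ {f : L.Carrier → M.Carrier} where

    map-⊆ : ∀ {A xs} → M.LowerSet A → L.listSet xs ⊆ preimage L M f A
          → M.listSet (map f xs) ⊆ A
    map-⊆ {xs = _ ∷ _} low xs⊆ (here w≈fx) = low (M.reflexive w≈fx) (xs⊆ (here L.Eq.refl))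
    map-⊆ {xs = _ ∷ _} low xs⊆ (there w∈) = map-⊆ low (λ x∈xs → xs⊆ (there x∈xs)) w∈

    map-upperBound : ∀ {xs v} → Monotone f → M.UpperBound (M.listSet (map f xs)) v
                   → L.listSet xs ⊆ preimage L M f (M.↓ v)
    map-upperBound {_ ∷ _} mono v-ub (here z≈x) =
      M.trans (mono (L.reflexive z≈x)) (v-ub (here M.Eq.refl))
    map-upperBound {_ ∷ _} mono v-ub (there z∈xs) =
      map-upperBound mono (λ w∈ → v-ub (there w∈)) z∈xs

    image-directed : ∀ {D} → Monotone f → L.Directed D → M.Directed (image L M f D)
    image-directed mono ((x , x∈D) , bound) =
      (f x , x , x∈D , M.Eq.refl) , λ (x₁ , x₁∈D , y₁≈) (x₂ , x₂∈D , y₂≈) →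
        let (z , z∈D , x₁≤z , x₂≤z) = bound x₁∈D x₂∈D in
        f z , (z , z∈D , M.Eq.refl) ,
        M.trans (M.reflexive y₁≈) (mono x₁≤z) , M.trans (M.reflexive y₂≈) (mono x₂≤z)

    image-⊆ : ∀ {A D} → M.LowerSet A → D ⊆ preimage L M f A → image L M f D ⊆ A
    image-⊆ low D⊆ (x , x∈D , y≈fx) = low (M.reflexive y≈fx) (D⊆ x∈D)

    finiteJoins⇒monotone : PreservesFiniteConsistentJoins L M f → Monotone f
    finiteJoins⇒monotone preserves {y} {x} y≤x =
      proj₁ (preserves y (x ∷ []) x (x , proj₁ (≤⇒isSup y≤x)) (≤⇒isSup y≤x)) (here M.Eq.refl)

    hom⇒fScottContinuous : IsHom L M f → FScottContinuous L M f
    hom⇒fScottContinuous (directedSups , finiteJoins) A ((low , directed) , finite) =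
      ((λ y≤x fx∈A → low (mono y≤x) fx∈A) ,
       λ D s D-directed D⊆ D-sup →
         directed (image L M f D) (f s) (image-directed mono D-directed)
           (image-⊆ low D⊆) (directedSups D s D-directed D-sup)) ,
      λ x xs s xs⊆ consistent x-sup →
        let fs-sup = finiteJoins x xs s consistent x-sup in
        finite (f x) (map f xs) (f s) (map-⊆ low xs⊆) (f s , proj₁ fs-sup) fs-sup
      where
      mono : Monotone f
      mono = finiteJoins⇒monotone finiteJoins

    module _ (continuous : FScottContinuous L M f) where
      private
        preimage-↓ : ∀ v → L.FScottClosed (preimage L M f (M.↓ v))
        preimage-↓ v = continuous (M.↓ v) (↓-fScottClosed v)

      fScottContinuous⇒monotone : Monotone f
      fScottContinuous⇒monotone {y} {x} y≤x =
        proj₁ (proj₁ (preimage-↓ (f x))) y≤x M.refl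

      fScottContinuous⇒hom : IsHom L M f
      fScottContinuous⇒hom = directedSups , finiteJoins
        where
        mono : Monotone f
        mono = fScottContinuous⇒monotone

        directedSups : PreservesDirectedSups L M f
        directedSups D s D-directed D-sup =
          image-⊆ (↓-lowerSet (f s)) (λ x∈D → mono (proj₁ D-sup x∈D)) ,
          λ v v-ub → proj₂ (proj₁ (preimage-↓ v)) D s D-directed
                       (λ x∈D → v-ub (_ , x∈D , M.Eq.refl)) D-sup

        finiteJoins : PreservesFiniteConsistentJoins L M f
        finiteJoins x xs s consistent x-sup =
          map-⊆ (↓-lowerSet (f s)) (λ z∈xs → mono (proj₁ x-sup z∈xs)) ,
          λ v v-ub → proj₂ (preimage-↓ v) x xs s (map-upperBound mono v-ub) consistent x-sup

proposition3p4 : ∀ {ℓ : Level}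
    → ((L M : DcpoJoinSL ℓ) (f : DcpoJoinSL.Carrier L → DcpoJoinSL.Carrier M)
        → IsHom L M f ⇔ FScottContinuous L M f)
    × ((L : DcpoJoinSL ℓ) (A : DcpoJoinSL.Sub L)
        → DcpoJoinSL.Nonempty L A → DcpoJoinSL.Consistent L A
        → ∃ λ s → DcpoJoinSL.IsSup L A s × (DcpoJoinSL.clF L A ≐ DcpoJoinSL.↓ L s))
proposition3p4 =
  (λ L M f → mk⇔ (Homomorphisms.hom⇒fScottContinuous L M)
                 (Homomorphisms.fScottContinuous⇒hom L M)) ,
  λ L A → Properties.consistent-sup-clF L
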